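{- Let $Q=\sum_{n\ge0}q_nX^n\in\mathbb{F}_2[[X]]$ be the composition inverse of $D=\sum_{n\ge0}b''_nX^n$, where $b''_0=0$ and $b''_n=b_{n-1}$ for $n\ge1$. Then for $n\in\mathbb{N}$, $q_n=1$ if and only if the base-$4$ expansion of $n$ contains only digits $0$ and $1$, except for the last (least significant) digit, which is either $1$ or $2$.
   Context: The Baum--Sweet sequence $(b_n)_{n\in\mathbb{N}}$ is defined by $b_0=1$ and, for $n\ge1$, $b_n=0$ if the binary expansion of $n$ contains a maximal block of consecutive $0$'s of odd length, and $b_n=1$ otherwise; it is viewed with values in $\mathbb{F}_2$. The composition inverse of $U\in\mathbb{F}_2[[X]]$ with zero constant term and nonzero $X$-coefficient is the unique $V$ with $U(V(X))=V(U(X))=X$. -}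

module Defs where

open import Data.Bool using (Bool; true; false; _∧_; _∨_; not; _xor_; if_then_else_)
open import Data.Nat using (ℕ; zero; suc; _∸_; _≡ᵇ_; _≤ᵇ_)
open import Data.Nat.DivMod using (_/_; _%_)
open import Data.List using (List; []; _∷_)

-- ℱ₂ is modelled by Bool (xor = addition, ∧ = multiplication).
-- Formal power series over ℱ₂: coefficient sequences.
PowerSeries : Set
PowerSeries = ℕ → Bool

sumUpTo : ℕ → (ℕ → Bool) → Bool
sumUpTo zero    f = f 0
sumUpTo (suc n) f = sumUpTo n f xor f (suc n)

_*ₛ_ : PowerSeries → PowerSeries → PowerSeries
(f *ₛ g) n = sumUpTo n (λ i → f i ∧ g (n ∸ i))

oneₛ : PowerSeries
oneₛ zero    = true
oneₛ (suc _) = false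

Xₛ : PowerSeries
Xₛ 1 = true
Xₛ _ = false

powₛ : PowerSeries → ℕ → PowerSeries
powₛ f zero    = oneₛ
powₛ f (suc k) = f *ₛ powₛ f k

-- Composition U(V(X)), meaningful when V 0 = false:
-- [Xⁿ] U(V) = Σ_{k ≤ n} u_k [Xⁿ] V^k   (terms k > n vanish since ord V^k ≥ k)
_∘ₛ_ : PowerSeries → PowerSeries → PowerSeries
(U ∘ₛ V) n = sumUpTo n (λ k → U k ∧ powₛ V k n)

-- Binary digits of n, least significant first (fuel-bounded; fuel n suffices)
bitsF : ℕ → ℕ → List Bool
bitsF zero    _       = []
bitsF (suc f) zero    = []
bitsF (suc f) (suc m) = ((suc m % 2) ≡ᵇ 1) ∷ bitsF f (suc m / 2)

bits : ℕ → List Bool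
bits n = bitsF n n

-- does the (LSB-first) digit list contain a maximal block of 0's of odd length?
-- p = parity of the current run of zeros
oddZeroRun : Bool → List Bool → Bool
oddZeroRun p []            = p
oddZeroRun p (false ∷ bs)  = oddZeroRun (not p) bs
oddZeroRun p (true ∷ bs)   = p ∨ oddZeroRun false bs

baumSweet : ℕ → Bool
baumSweet zero    = true
baumSweet (suc n) = not (oddZeroRun false (bits (suc n)))

D : PowerSeries
D zero    = false
D (suc n) = baumSweet n

-- Base-4 digits of n, least significant first; base4 0 = [0]
base4F : ℕ → ℕ → List ℕ
base4F zero    _       = []
base4F (suc f) zero    = []
base4F (suc f) (suc m) = (suc m % 4) ∷ base4F f (suc m / 4)

base4 : ℕ → List ℕ
base4 zero    = 0 ∷ []
base4 (suc m) = base4F (suc m) (suc m)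

allBinary : List ℕ → Bool
allBinary []       = true
allBinary (e ∷ es) = (e ≤ᵇ 1) ∧ allBinary es

goodDigits : List ℕ → Bool
goodDigits []       = false
goodDigits (d ∷ ds) = ((d ≡ᵇ 1) ∨ (d ≡ᵇ 2)) ∧ allBinary ds

module Submission where

-- Write B = Σ bₙ Xⁿ for the Baum–Sweet series, so D = X·B, and let
-- H = Σ hₙ Xⁿ with hₙ = 1 iff every base-4 digit of n is 0 or 1, and G = X·H,
-- whose coefficients are exactly the ones claimed for Q.  Over 𝔽₂ the Frobenius
-- map gives F(X)² = F(X²), and the digit descriptions of B and H turn into
--   B⁴ = B·(1 + D)        and        H = (1 + X)·H⁴.
-- Substituting D into the second equation gives K = (1 + D)·K⁴ for K = H(D), so
-- P = B·K satisfies P⁴ = B(1+D)·K⁴ = P with P(0) = 1, which forces P = 1.  Hence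
-- G(D) = D·K = X·B·K = X.  Since Q(D) = X as well and composition on the right
-- with a series X + O(X²) is injective, Q = G.

open import Defs
open import Algebra.Bundles using (CommutativeRing; CommutativeMonoid)
open import Data.Bool using (Bool; true; false; _∧_; not; _xor_)
open import Data.Bool.Properties
  using (xor-∧-commutativeRing; ∧-commutativeMonoid; xor-assoc; xor-comm; xor-same; xor-identityʳ;
         ∧-distribˡ-xor; ∧-distribʳ-xor; ∧-comm; ∧-assoc; ∧-idem; ∧-zeroʳ; ∧-identityʳ)
open import Data.Nat using (ℕ; zero; suc; _+_; _*_; _∸_; _≤_; _<_; z≤n; s≤s; _≡ᵇ_; NonZero)
open import Data.Nat.Properties
  using (≤-refl; ≤-trans; ≤-pred; m≤n⇒m≤1+n; m≤n⇒m<n∨m≡n; <⇒≢; ≤∧≢⇒<;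
         +-identityʳ; +-suc; +-∸-assoc; ∸-+-assoc; m+[n∸m]≡n; m+n∸m≡n; m∸[m∸n]≡n; n∸n≡0;
         m∸n≤m; +-monoʳ-<; +-cancelˡ-≡; *-cancelʳ-≡)
open import Data.Nat.DivMod using (_/_; _%_; m≡m%n+[m/n]*n; [m+kn]%n≡m%n; m<n⇒m%n≡m; m/n<m)
open import Data.Nat.Induction using (<-rec)
open import Data.List using (List; _∷_)
open import Data.Product using (_×_; _,_; proj₁; proj₂)
open import Data.Sum using (inj₁; inj₂)
open import Data.Empty using (⊥-elim)
open import Function.Bundles using (_⇔_; mk⇔)
open import Relation.Binary.Bundles using (Setoid)
open import Relation.Binary.PropositionalEquality
import Relation.Binary.Reasoning.Setoid
open import Algebra.Properties.CommutativeSemigroup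
  (CommutativeRing.+-commutativeSemigroup xor-∧-commutativeRing)
  using () renaming (interchange to xor-interchange)
open import Algebra.Properties.CommutativeSemigroup
  (CommutativeMonoid.commutativeSemigroup ∧-commutativeMonoid)
  using () renaming (interchange to ∧-interchange)

xor-cancel-outer : ∀ x s → (x xor s) xor x ≡ s
xor-cancel-outer false false = refl
xor-cancel-outer false true  = refl
xor-cancel-outer true  false = refl
xor-cancel-outer true  true  = refl

xor≡false⇒≡ : ∀ a b → a xor b ≡ false → a ≡ b
xor≡false⇒≡ false false _ = refl
xor≡false⇒≡ true  true  _ = refl
xor≡false⇒≡ false true  ()
xor≡false⇒≡ true  false ()

sum-ext : ∀ n {f g : ℕ → Bool} → (∀ i → i ≤ n → f i ≡ g i) → sumUpTo n f ≡ sumUpTo n g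
sum-ext zero    h = h 0 z≤n
sum-ext (suc n) h = cong₂ _xor_ (sum-ext n (λ i p → h i (m≤n⇒m≤1+n p))) (h (suc n) ≤-refl)

sum-vanish : ∀ n (f : ℕ → Bool) → (∀ i → i ≤ n → f i ≡ false) → sumUpTo n f ≡ false
sum-vanish zero    f h = h 0 z≤n
sum-vanish (suc n) f h = cong₂ _xor_ (sum-vanish n f (λ i p → h i (m≤n⇒m≤1+n p))) (h (suc n) ≤-refl)

sum-xor : ∀ n f g → sumUpTo n (λ i → f i xor g i) ≡ sumUpTo n f xor sumUpTo n g
sum-xor zero    f g = refl
sum-xor (suc n) f g = trans (cong (_xor (f (suc n) xor g (suc n))) (sum-xor n f g))
  (xor-interchange (sumUpTo n f) (sumUpTo n g) (f (suc n)) (g (suc n)))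

sum-∧ˡ : ∀ n b f → b ∧ sumUpTo n f ≡ sumUpTo n (λ i → b ∧ f i)
sum-∧ˡ n true  f = refl
sum-∧ˡ n false f = sym (sum-vanish n (λ _ → false) (λ _ _ → refl))

sum-∧ʳ : ∀ n b f → sumUpTo n f ∧ b ≡ sumUpTo n (λ i → f i ∧ b)
sum-∧ʳ n b f = trans (∧-comm (sumUpTo n f) b)
  (trans (sum-∧ˡ n b f) (sum-ext n (λ i _ → ∧-comm b (f i))))

sum-shift : ∀ n f → sumUpTo (suc n) f ≡ f 0 xor sumUpTo n (λ i → f (suc i))
sum-shift zero    f = refl
sum-shift (suc n) f = trans (cong (_xor f (suc (suc n))) (sum-shift n f)) (xor-assoc (f 0) _ _)

sum-extend : ∀ {m} n f → m ≤ n → (∀ i → m < i → i ≤ n → f i ≡ false) → sumUpTo n f ≡ sumUpTo m f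
sum-extend {zero} zero f z≤n h = refl
sum-extend {m} (suc n) f m≤1+n h with m≤n⇒m<n∨m≡n m≤1+n
... | inj₂ refl        = refl
... | inj₁ (s≤s m≤n) =
  trans (cong₂ _xor_ (sum-extend n f m≤n (λ i p q → h i p (m≤n⇒m≤1+n q))) (h (suc n) (s≤s m≤n) ≤-refl))
        (xor-identityʳ _)

sum-single : ∀ n k f → k ≤ n → (∀ i → i ≤ n → i ≢ k → f i ≡ false) → sumUpTo n f ≡ f k
sum-single zero .zero f z≤n h = refl
sum-single (suc n) k f k≤1+n h with m≤n⇒m<n∨m≡n k≤1+n
... | inj₂ refl = cong (_xor f (suc n))
        (sum-vanish n f (λ i p → h i (m≤n⇒m≤1+n p) (λ e → <⇒≢ (s≤s p) e)))
... | inj₁ (s≤s k≤n) =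
  trans (cong₂ _xor_ (sum-single n k f k≤n (λ i p q → h i (m≤n⇒m≤1+n p) q))
                     (h (suc n) ≤-refl (λ e → <⇒≢ (s≤s k≤n) (sym e))))
        (xor-identityʳ _)

sum-reverse : ∀ n f → sumUpTo n f ≡ sumUpTo n (λ i → f (n ∸ i))
sum-reverse zero    f = refl
sum-reverse (suc n) f = trans (cong (_xor f (suc n)) (sum-reverse n f))
  (trans (xor-comm _ (f (suc n))) (sym (sum-shift n (λ i → f (suc n ∸ i)))))

sum-swap : ∀ n m (f : ℕ → ℕ → Bool) →
  sumUpTo n (λ i → sumUpTo m (f i)) ≡ sumUpTo m (λ j → sumUpTo n (λ i → f i j))
sum-swap zero    m f = refl
sum-swap (suc n) m f = trans (cong (_xor sumUpTo m (f (suc n))) (sum-swap n m f))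
  (sym (sum-xor m (λ j → sumUpTo n (λ i → f i j)) (f (suc n))))

sum-triangle : ∀ n (F : ℕ → ℕ → Bool) →
  sumUpTo n (λ k → sumUpTo k (λ i → F i k)) ≡ sumUpTo n (λ i → sumUpTo (n ∸ i) (λ j → F i (i + j)))
sum-triangle zero    F = refl
sum-triangle (suc n) F = begin
    sumUpTo n (λ k → sumUpTo k (λ i → F i k)) xor (sumUpTo n (λ i → F i (suc n)) xor F (suc n) (suc n))
  ≡⟨ cong (_xor (sumUpTo n (λ i → F i (suc n)) xor F (suc n) (suc n))) (sum-triangle n F) ⟩
    inner n xor (sumUpTo n (λ i → F i (suc n)) xor F (suc n) (suc n))
  ≡⟨ sym (xor-assoc (inner n) _ _) ⟩
    (inner n xor sumUpTo n (λ i → F i (suc n))) xor F (suc n) (suc n)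
  ≡⟨ cong₂ _xor_ (sym (sum-xor n _ _)) (cong (F (suc n)) (sym (+-identityʳ (suc n)))) ⟩
    sumUpTo n (λ i → sumUpTo (n ∸ i) (λ j → F i (i + j)) xor F i (suc n)) xor F (suc n) (suc n + 0)
  ≡⟨ cong₂ _xor_ (sum-ext n extend-row) (cong (λ m → sumUpTo m (λ j → F (suc n) (suc n + j))) (sym (n∸n≡0 n))) ⟩
    inner (suc n)
  ∎
  where
  open ≡-Reasoning
  inner : ℕ → Bool
  inner m = sumUpTo m (λ i → sumUpTo (m ∸ i) (λ j → F i (i + j)))
  -- row i of the triangle gains the single term at k = n + 1
  extend-row : ∀ i → i ≤ n →
    sumUpTo (n ∸ i) (λ j → F i (i + j)) xor F i (suc n) ≡ sumUpTo (suc n ∸ i) (λ j → F i (i + j))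
  extend-row i i≤n rewrite +-∸-assoc 1 i≤n = cong (λ z → sumUpTo (n ∸ i) (λ j → F i (i + j)) xor F i z)
    (sym (trans (+-suc i (n ∸ i)) (cong suc (m+[n∸m]≡n i≤n))))

-- Power series over 𝔽₂ form a commutative ring (up to pointwise equality).

infix 4 _≈_
_≈_ : PowerSeries → PowerSeries → Set
f ≈ g = ∀ n → f n ≡ g n

≈-refl : ∀ {f} → f ≈ f
≈-refl n = refl

≈-sym : ∀ {f g} → f ≈ g → g ≈ f
≈-sym p n = sym (p n)

≈-trans : ∀ {f g h} → f ≈ g → g ≈ h → f ≈ h
≈-trans p q n = trans (p n) (q n)

PowerSeriesSetoid : Setoid _ _
PowerSeriesSetoid = record
  { Carrier = PowerSeries ; _≈_ = _≈_
  ; isEquivalence = record { refl = ≈-refl ; sym = ≈-sym ; trans = ≈-trans } }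

module ≈-Reasoning = Relation.Binary.Reasoning.Setoid PowerSeriesSetoid

infixl 6 _+ₛ_
_+ₛ_ : PowerSeries → PowerSeries → PowerSeries
(f +ₛ g) n = f n xor g n

zeroₛ : PowerSeries
zeroₛ _ = false

+-cong : ∀ {f f′ g g′} → f ≈ f′ → g ≈ g′ → f +ₛ g ≈ f′ +ₛ g′
+-cong p q n = cong₂ _xor_ (p n) (q n)

*-cong : ∀ {f f′ g g′} → f ≈ f′ → g ≈ g′ → f *ₛ g ≈ f′ *ₛ g′
*-cong p q n = sum-ext n (λ i _ → cong₂ _∧_ (p i) (q (n ∸ i)))

*-comm : ∀ f g → f *ₛ g ≈ g *ₛ f
*-comm f g n = trans (sum-reverse n (λ i → f i ∧ g (n ∸ i)))
  (sum-ext n (λ i i≤n → trans (cong (λ z → f (n ∸ i) ∧ g z) (m∸[m∸n]≡n i≤n)) (∧-comm (f (n ∸ i)) (g i))))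

*-distribˡ-+ : ∀ f g h → f *ₛ (g +ₛ h) ≈ f *ₛ g +ₛ f *ₛ h
*-distribˡ-+ f g h n = trans (sum-ext n (λ i _ → ∧-distribˡ-xor (f i) (g (n ∸ i)) (h (n ∸ i))))
  (sum-xor n _ _)

*-distribʳ-+ : ∀ f g h → (g +ₛ h) *ₛ f ≈ g *ₛ f +ₛ h *ₛ f
*-distribʳ-+ f g h = ≈-trans (*-comm (g +ₛ h) f)
  (≈-trans (*-distribˡ-+ f g h) (+-cong (*-comm f g) (*-comm f h)))

*-assoc : ∀ f g h → (f *ₛ g) *ₛ h ≈ f *ₛ (g *ₛ h)
*-assoc f g h n = begin
    sumUpTo n (λ k → sumUpTo k (λ i → f i ∧ g (k ∸ i)) ∧ h (n ∸ k))
  ≡⟨ sum-ext n (λ k _ → sum-∧ʳ k (h (n ∸ k)) (λ i → f i ∧ g (k ∸ i))) ⟩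
    sumUpTo n (λ k → sumUpTo k (λ i → (f i ∧ g (k ∸ i)) ∧ h (n ∸ k)))
  ≡⟨ sum-triangle n (λ i k → (f i ∧ g (k ∸ i)) ∧ h (n ∸ k)) ⟩
    sumUpTo n (λ i → sumUpTo (n ∸ i) (λ j → (f i ∧ g (i + j ∸ i)) ∧ h (n ∸ (i + j))))
  ≡⟨ sum-ext n (λ i _ → sum-ext (n ∸ i) (λ j _ →
       trans (cong₂ (λ a b → (f i ∧ g a) ∧ h b) (m+n∸m≡n i j) (sym (∸-+-assoc n i j)))
             (∧-assoc (f i) (g j) (h (n ∸ i ∸ j))))) ⟩
    sumUpTo n (λ i → sumUpTo (n ∸ i) (λ j → f i ∧ (g j ∧ h (n ∸ i ∸ j))))
  ≡⟨ sum-ext n (λ i _ → sym (sum-∧ˡ (n ∸ i) (f i) (λ j → g j ∧ h (n ∸ i ∸ j)))) ⟩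
    sumUpTo n (λ i → f i ∧ sumUpTo (n ∸ i) (λ j → g j ∧ h (n ∸ i ∸ j)))
  ∎
  where open ≡-Reasoning

*-identityˡ : ∀ f → oneₛ *ₛ f ≈ f
*-identityˡ f n = sum-single n 0 _ z≤n only-zero
  where
  only-zero : ∀ i → i ≤ n → i ≢ 0 → oneₛ i ∧ f (n ∸ i) ≡ false
  only-zero zero    _ i≢0 = ⊥-elim (i≢0 refl)
  only-zero (suc i) _ _   = refl

*-identityʳ : ∀ f → f *ₛ oneₛ ≈ f
*-identityʳ f = ≈-trans (*-comm f oneₛ) (*-identityˡ f)

X*-suc : ∀ f n → (Xₛ *ₛ f) (suc n) ≡ f n
X*-suc f n = sum-single (suc n) 1 _ (s≤s z≤n) only-one
  where
  only-one : ∀ i → i ≤ suc n → i ≢ 1 → Xₛ i ∧ f (suc n ∸ i) ≡ false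
  only-one zero          _ _   = refl
  only-one (suc zero)    _ i≢1 = ⊥-elim (i≢1 refl)
  only-one (suc (suc i)) _ _   = refl

-- The Frobenius identity F(X)² = F(X²) in characteristic 2.

sq : PowerSeries → PowerSeries
sq f = f *ₛ f

dbl : ℕ → ℕ
dbl zero    = zero
dbl (suc n) = suc (suc (dbl n))

n≤dbl : ∀ n → n ≤ dbl n
n≤dbl zero    = z≤n
n≤dbl (suc n) = s≤s (m≤n⇒m≤1+n (n≤dbl n))

dbl∸n≡n : ∀ n → dbl n ∸ n ≡ n
dbl∸n≡n zero    = refl
dbl∸n≡n (suc n) = trans (+-∸-assoc 1 (n≤dbl n)) (cong suc (dbl∸n≡n n))

-- The summands of a coefficient of a square are symmetric about the middle,
-- so over 𝔽₂ they cancel in pairs.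
Palindromic : ℕ → (ℕ → Bool) → Set
Palindromic m a = ∀ i → i ≤ m → a i ≡ a (m ∸ i)

palindromic-inner : ∀ {m a} → Palindromic (suc (suc m)) a → Palindromic m (λ i → a (suc i))
palindromic-inner {a = a} h i i≤m = trans (h (suc i) (s≤s (m≤n⇒m≤1+n i≤m))) (cong a (+-∸-assoc 1 i≤m))

sum-drop-ends : ∀ m a → a 0 ≡ a (suc (suc m)) →
  sumUpTo (suc (suc m)) a ≡ sumUpTo m (λ i → a (suc i))
sum-drop-ends m a a0≡last = begin
    sumUpTo (suc m) a xor a (suc (suc m))
  ≡⟨ cong₂ _xor_ (sum-shift m a) (sym a0≡last) ⟩
    (a 0 xor sumUpTo m (λ i → a (suc i))) xor a 0
  ≡⟨ xor-cancel-outer (a 0) _ ⟩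
    sumUpTo m (λ i → a (suc i))
  ∎
  where open ≡-Reasoning

palindrome-even : ∀ n a → Palindromic (dbl n) a → sumUpTo (dbl n) a ≡ a n
palindrome-even zero    a h = refl
palindrome-even (suc n) a h =
  trans (sum-drop-ends (dbl n) a (h 0 z≤n)) (palindrome-even n (λ i → a (suc i)) (palindromic-inner h))

palindrome-odd : ∀ n a → Palindromic (suc (dbl n)) a → sumUpTo (suc (dbl n)) a ≡ false
palindrome-odd zero    a h = trans (cong (_xor a 1) (h 0 z≤n)) (xor-same (a 1))
palindrome-odd (suc n) a h =
  trans (sum-drop-ends (suc (dbl n)) a (h 0 z≤n)) (palindrome-odd n (λ i → a (suc i)) (palindromic-inner h))

squareTerm : PowerSeries → ℕ → ℕ → Bool
squareTerm f m i = f i ∧ f (m ∸ i)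

square-palindromic : ∀ f m → Palindromic m (squareTerm f m)
square-palindromic f m i i≤m = trans (∧-comm (f i) (f (m ∸ i))) (cong (λ z → f (m ∸ i) ∧ f z) (sym (m∸[m∸n]≡n i≤m)))

sq-even : ∀ f n → sq f (dbl n) ≡ f n
sq-even f n = trans (palindrome-even n (squareTerm f (dbl n)) (square-palindromic f (dbl n)))
  (trans (cong (λ z → f n ∧ f z) (dbl∸n≡n n)) (∧-idem (f n)))

sq-odd : ∀ f n → sq f (suc (dbl n)) ≡ false
sq-odd f n = palindrome-odd n (squareTerm f (suc (dbl n))) (square-palindromic f (suc (dbl n)))

sq-cong : ∀ {f g} → f ≈ g → sq f ≈ sq g
sq-cong p = *-cong p p

sq-* : ∀ f g → sq (f *ₛ g) ≈ sq f *ₛ sq g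
sq-* f g = begin
    (f *ₛ g) *ₛ (f *ₛ g)  ≈⟨ *-assoc f g (f *ₛ g) ⟩
    f *ₛ (g *ₛ (f *ₛ g))  ≈⟨ *-cong (≈-refl {f}) (≈-sym (*-assoc g f g)) ⟩
    f *ₛ ((g *ₛ f) *ₛ g)  ≈⟨ *-cong (≈-refl {f}) (*-cong (*-comm g f) (≈-refl {g})) ⟩
    f *ₛ ((f *ₛ g) *ₛ g)  ≈⟨ *-cong (≈-refl {f}) (*-assoc f g g) ⟩
    f *ₛ (f *ₛ (g *ₛ g))  ≈⟨ ≈-sym (*-assoc f f (g *ₛ g)) ⟩
    sq f *ₛ sq g          ∎
  where open ≈-Reasoning

-- Fourth powers: F⁴ = F(X⁴), read off along the residues of n modulo 4.

data Residue4 : ℕ → Set where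
  4q+0 : ∀ q → Residue4 (dbl (dbl q))
  4q+1 : ∀ q → Residue4 (suc (dbl (dbl q)))
  4q+2 : ∀ q → Residue4 (suc (suc (dbl (dbl q))))
  4q+3 : ∀ q → Residue4 (suc (suc (suc (dbl (dbl q)))))

residue4 : ∀ n → Residue4 n
residue4 zero                      = 4q+0 0
residue4 (suc zero)                = 4q+1 0
residue4 (suc (suc zero))          = 4q+2 0
residue4 (suc (suc (suc zero)))    = 4q+3 0
residue4 (suc (suc (suc (suc n)))) with residue4 n
... | 4q+0 q = 4q+0 (suc q)
... | 4q+1 q = 4q+1 (suc q)
... | 4q+2 q = 4q+2 (suc q)
... | 4q+3 q = 4q+3 (suc q)

fourth : PowerSeries → PowerSeries
fourth f = sq (sq f)

fourth-0 : ∀ f q → fourth f (dbl (dbl q)) ≡ f q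
fourth-0 f q = trans (sq-even (sq f) (dbl q)) (sq-even f q)

fourth-1 : ∀ f q → fourth f (suc (dbl (dbl q))) ≡ false
fourth-1 f q = sq-odd (sq f) (dbl q)

fourth-2 : ∀ f q → fourth f (suc (suc (dbl (dbl q)))) ≡ false
fourth-2 f q = trans (sq-even (sq f) (suc (dbl q))) (sq-odd f q)

fourth-3 : ∀ f q → fourth f (suc (suc (suc (dbl (dbl q))))) ≡ false
fourth-3 f q = sq-odd (sq f) (suc (dbl q))

-- A series with constant term 1 that equals its own fourth power is 1:
-- its coefficients at 4q+1, 4q+2, 4q+3 vanish and the one at 4q equals that at q.
fourth-fixed-point : ∀ P → P 0 ≡ true → P ≈ fourth P → P ≈ oneₛ
fourth-fixed-point P P0 P≈P⁴ = <-rec (λ n → P n ≡ oneₛ n) step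
  where
  step : ∀ n → (∀ {m} → m < n → P m ≡ oneₛ m) → P n ≡ oneₛ n
  step n ih with residue4 n
  ... | 4q+0 zero    = P0
  ... | 4q+0 (suc q) = trans (P≈P⁴ _) (trans (fourth-0 P (suc q)) (ih q<4q))
    where q<4q = ≤-trans (s≤s (s≤s (n≤dbl q))) (n≤dbl (dbl (suc q)))
  ... | 4q+1 q = trans (P≈P⁴ _) (fourth-1 P q)
  ... | 4q+2 q = trans (P≈P⁴ _) (fourth-2 P q)
  ... | 4q+3 q = trans (P≈P⁴ _) (fourth-3 P q)

-- Composition U(W) = Σ uₖ Wᵏ for W with zero constant term (the '_∘ₛ_' of Defs).

pow-+ : ∀ W a b → powₛ W (a + b) ≈ powₛ W a *ₛ powₛ W b
pow-+ W zero    b = ≈-sym (*-identityˡ (powₛ W b))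
pow-+ W (suc a) b = ≈-trans (*-cong (≈-refl {W}) (pow-+ W a b)) (≈-sym (*-assoc W (powₛ W a) (powₛ W b)))

m∸[1+i]<m : ∀ m i → suc i ≤ m → m ∸ suc i < m
m∸[1+i]<m (suc m) i _ = s≤s (m∸n≤m m i)

pow-below : ∀ W → W 0 ≡ false → ∀ k n → n < k → powₛ W k n ≡ false
pow-below W W0 (suc k) n n<1+k = sum-vanish n _ term
  where
  term : ∀ i → i ≤ n → W i ∧ powₛ W k (n ∸ i) ≡ false
  term zero    _ = cong (_∧ powₛ W k n) W0
  term (suc i) i<n = trans (cong (W (suc i) ∧_)
    (pow-below W W0 k (n ∸ suc i) (≤-trans (m∸[1+i]<m n i i<n) (≤-pred n<1+k)))) (∧-zeroʳ _)

pow-diagonal : ∀ W → W 0 ≡ false → W 1 ≡ true → ∀ k → powₛ W k k ≡ true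
pow-diagonal W W0 W1 zero    = refl
pow-diagonal W W0 W1 (suc k) =
  trans (sum-single (suc k) 1 _ (s≤s z≤n) only-one) (cong₂ _∧_ W1 (pow-diagonal W W0 W1 k))
  where
  only-one : ∀ i → i ≤ suc k → i ≢ 1 → W i ∧ powₛ W k (suc k ∸ i) ≡ false
  only-one zero          _ _   = cong (_∧ powₛ W k (suc k)) W0
  only-one (suc zero)    _ i≢1 = ⊥-elim (i≢1 refl)
  only-one (suc (suc i)) (s≤s i<k) _ =
    trans (cong (W (suc (suc i)) ∧_) (pow-below W W0 k (k ∸ suc i) (m∸[1+i]<m k i i<k))) (∧-zeroʳ _)

∘-congˡ : ∀ {U V} W → U ≈ V → (U ∘ₛ W) ≈ (V ∘ₛ W)
∘-congˡ W p n = sum-ext n (λ k _ → cong (_∧ powₛ W k n) (p k))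

∘-+ : ∀ U V W → ((U +ₛ V) ∘ₛ W) ≈ (U ∘ₛ W) +ₛ (V ∘ₛ W)
∘-+ U V W n = trans (sum-ext n (λ k _ → ∧-distribʳ-xor (powₛ W k n) (U k) (V k))) (sum-xor n _ _)

∘-extend : ∀ W → W 0 ≡ false → ∀ U n N → n ≤ N → (U ∘ₛ W) n ≡ sumUpTo N (λ k → U k ∧ powₛ W k n)
∘-extend W W0 U n N n≤N =
  sym (sum-extend N _ n≤N (λ k n<k _ → trans (cong (U k ∧_) (pow-below W W0 k n n<k)) (∧-zeroʳ _)))

one-∘ : ∀ W → (oneₛ ∘ₛ W) ≈ oneₛ
one-∘ W n = sum-single n 0 _ z≤n only-zero
  where
  only-zero : ∀ k → k ≤ n → k ≢ 0 → oneₛ k ∧ powₛ W k n ≡ false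
  only-zero zero    _ k≢0 = ⊥-elim (k≢0 refl)
  only-zero (suc k) _ _   = refl

X-∘ : ∀ W → W 0 ≡ false → (Xₛ ∘ₛ W) ≈ W
X-∘ W W0 zero    = sym W0
X-∘ W W0 (suc n) = trans (sum-single (suc n) 1 _ (s≤s z≤n) only-one) (*-identityʳ W (suc n))
  where
  only-one : ∀ k → k ≤ suc n → k ≢ 1 → Xₛ k ∧ powₛ W k (suc n) ≡ false
  only-one zero          _ _   = refl
  only-one (suc zero)    _ k≢1 = ⊥-elim (k≢1 refl)
  only-one (suc (suc k)) _ _   = refl

-- Both (U·V)(W) and U(W)·V(W) expand to the double sum of these terms over a, b ≤ n.
crossTerm : PowerSeries → PowerSeries → PowerSeries → ℕ → ℕ → ℕ → Bool
crossTerm U V W n a b = (U a ∧ V b) ∧ powₛ W (a + b) n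

∘-of-product : ∀ U V W → W 0 ≡ false → ∀ n →
  ((U *ₛ V) ∘ₛ W) n ≡ sumUpTo n (λ a → sumUpTo n (crossTerm U V W n a))
∘-of-product U V W W0 n = begin
    sumUpTo n (λ k → sumUpTo k (λ a → U a ∧ V (k ∸ a)) ∧ powₛ W k n)
  ≡⟨ sum-ext n (λ k _ → sum-∧ʳ k (powₛ W k n) (λ a → U a ∧ V (k ∸ a))) ⟩
    sumUpTo n (λ k → sumUpTo k (λ a → (U a ∧ V (k ∸ a)) ∧ powₛ W k n))
  ≡⟨ sum-triangle n (λ a k → (U a ∧ V (k ∸ a)) ∧ powₛ W k n) ⟩
    sumUpTo n (λ a → sumUpTo (n ∸ a) (λ b → (U a ∧ V (a + b ∸ a)) ∧ powₛ W (a + b) n))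
  ≡⟨ sum-ext n (λ a a≤n → trans
       (sum-ext (n ∸ a) (λ b _ → cong (λ z → (U a ∧ V z) ∧ powₛ W (a + b) n) (m+n∸m≡n a b)))
       (sym (sum-extend n (crossTerm U V W n a) (m∸n≤m n a) (λ b n∸a<b _ →
          trans (cong ((U a ∧ V b) ∧_) (pow-below W W0 (a + b) n (n<a+b a≤n n∸a<b))) (∧-zeroʳ _))))) ⟩
    sumUpTo n (λ a → sumUpTo n (crossTerm U V W n a))
  ∎
  where
  open ≡-Reasoning
  n<a+b : ∀ {a b} → a ≤ n → n ∸ a < b → n < a + b
  n<a+b {a} {b} a≤n n∸a<b = subst (_< a + b) (m+[n∸m]≡n a≤n) (+-monoʳ-< a n∸a<b)

product-of-∘ : ∀ U V W → W 0 ≡ false → ∀ n →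
  ((U ∘ₛ W) *ₛ (V ∘ₛ W)) n ≡ sumUpTo n (λ a → sumUpTo n (crossTerm U V W n a))
product-of-∘ U V W W0 n = begin
    sumUpTo n (λ i → (U ∘ₛ W) i ∧ (V ∘ₛ W) (n ∸ i))
  ≡⟨ sum-ext n (λ i i≤n → cong₂ _∧_ (∘-extend W W0 U i n i≤n) (∘-extend W W0 V (n ∸ i) n (m∸n≤m n i))) ⟩
    sumUpTo n (λ i → sumUpTo n (λ a → U a ∧ powₛ W a i) ∧ sumUpTo n (λ b → V b ∧ powₛ W b (n ∸ i)))
  ≡⟨ sum-ext n (λ i _ → trans (sum-∧ʳ n _ (λ a → U a ∧ powₛ W a i))
        (sum-ext n (λ a _ → sum-∧ˡ n (U a ∧ powₛ W a i) (λ b → V b ∧ powₛ W b (n ∸ i))))) ⟩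
    sumUpTo n (λ i → sumUpTo n (λ a → sumUpTo n (λ b → term a b i)))
  ≡⟨ sum-swap n n _ ⟩
    sumUpTo n (λ a → sumUpTo n (λ i → sumUpTo n (λ b → term a b i)))
  ≡⟨ sum-ext n (λ a _ → sum-swap n n _) ⟩
    sumUpTo n (λ a → sumUpTo n (λ b → sumUpTo n (term a b)))
  ≡⟨ sum-ext n (λ a _ → sum-ext n (λ b _ → regroup a b)) ⟩
    sumUpTo n (λ a → sumUpTo n (crossTerm U V W n a))
  ∎
  where
  open ≡-Reasoning
  term : ℕ → ℕ → ℕ → Bool
  term a b i = (U a ∧ powₛ W a i) ∧ (V b ∧ powₛ W b (n ∸ i))
  -- the inner sum over i is the coefficient of Xⁿ in Wᵃ·Wᵇ = Wᵃ⁺ᵇ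
  regroup : ∀ a b → sumUpTo n (term a b) ≡ crossTerm U V W n a b
  regroup a b = begin
      sumUpTo n (term a b)
    ≡⟨ sum-ext n (λ i _ → ∧-interchange (U a) (powₛ W a i) (V b) (powₛ W b (n ∸ i))) ⟩
      sumUpTo n (λ i → (U a ∧ V b) ∧ (powₛ W a i ∧ powₛ W b (n ∸ i)))
    ≡⟨ sym (sum-∧ˡ n (U a ∧ V b) _) ⟩
      (U a ∧ V b) ∧ (powₛ W a *ₛ powₛ W b) n
    ≡⟨ cong ((U a ∧ V b) ∧_) (sym (pow-+ W a b n)) ⟩
      crossTerm U V W n a b
    ∎

∘-* : ∀ U V W → W 0 ≡ false → ((U *ₛ V) ∘ₛ W) ≈ ((U ∘ₛ W) *ₛ (V ∘ₛ W))
∘-* U V W W0 n = trans (∘-of-product U V W W0 n) (sym (product-of-∘ U V W W0 n))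

-- Composition on the right with W = X + O(X²) is injective: if U(W) = 0, the
-- coefficient of Xⁿ in U(W) is uₙ plus terms uₖ with k < n, so uₙ = 0 by induction.
∘-vanishing : ∀ U W → W 0 ≡ false → W 1 ≡ true → (U ∘ₛ W) ≈ zeroₛ → U ≈ zeroₛ
∘-vanishing U W W0 W1 U∘W≈0 = <-rec (λ n → U n ≡ false) step
  where
  step : ∀ n → (∀ {m} → m < n → U m ≡ false) → U n ≡ false
  step n ih = begin
      U n                         ≡⟨ sym (∧-identityʳ (U n)) ⟩
      U n ∧ true                  ≡⟨ cong (U n ∧_) (sym (pow-diagonal W W0 W1 n)) ⟩
      U n ∧ powₛ W n n            ≡⟨ sym (sum-single n n _ ≤-refl (λ k k≤n k≢n → cong (_∧ powₛ W k n) (ih (≤∧≢⇒< k≤n k≢n)))) ⟩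
      (U ∘ₛ W) n                  ≡⟨ U∘W≈0 n ⟩
      false                       ∎
    where open ≡-Reasoning

∘-injective : ∀ U V W → W 0 ≡ false → W 1 ≡ true → (U ∘ₛ W) ≈ (V ∘ₛ W) → U ≈ V
∘-injective U V W W0 W1 U∘W≈V∘W n = xor≡false⇒≡ (U n) (V n) (∘-vanishing (U +ₛ V) W W0 W1 sum∘W≈0 n)
  where
  sum∘W≈0 : ((U +ₛ V) ∘ₛ W) ≈ zeroₛ
  sum∘W≈0 m = trans (∘-+ U V W m) (trans (cong (_xor (V ∘ₛ W) m) (U∘W≈V∘W m)) (xor-same ((V ∘ₛ W) m)))

-- Binary and base-4 digits.

divMod-unique : ∀ q r d .{{_ : NonZero d}} → r < d → ((r + q * d) % d ≡ r) × ((r + q * d) / d ≡ q)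
divMod-unique q r d r<d = rem , quot
  where
  rem = trans ([m+kn]%n≡m%n r q d) (m<n⇒m%n≡m r<d)
  n = r + q * d
  n≡r+[n/d]*d : r + q * d ≡ r + (n / d) * d
  n≡r+[n/d]*d = trans (m≡m%n+[m/n]*n n d) (cong (_+ (n / d) * d) rem)
  quot = sym (*-cancelʳ-≡ q (n / d) d (+-cancelˡ-≡ r _ _ n≡r+[n/d]*d))

dbl≡*2 : ∀ q → dbl q ≡ q * 2
dbl≡*2 zero    = refl
dbl≡*2 (suc q) = cong (λ z → suc (suc z)) (dbl≡*2 q)

dbl-dbl≡*4 : ∀ q → dbl (dbl q) ≡ q * 4
dbl-dbl≡*4 zero    = refl
dbl-dbl≡*4 (suc q) = cong (λ z → suc (suc (suc (suc z)))) (dbl-dbl≡*4 q)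

bitsF-fuel : ∀ f g n → n ≤ f → n ≤ g → bitsF f n ≡ bitsF g n
bitsF-fuel zero    zero    n       _       _       = refl
bitsF-fuel zero    (suc g) zero    _       _       = refl
bitsF-fuel (suc f) zero    zero    _       _       = refl
bitsF-fuel (suc f) (suc g) zero    _       _       = refl
bitsF-fuel (suc f) (suc g) (suc m) (s≤s p) (s≤s q) =
  cong (_ ∷_) (bitsF-fuel f g (suc m / 2) (≤-trans half≤m p) (≤-trans half≤m q))
  where half≤m = ≤-pred (m/n<m (suc m) 2 (s≤s (s≤s z≤n)))

base4F-fuel : ∀ f g n → n ≤ f → n ≤ g → base4F f n ≡ base4F g n
base4F-fuel zero    zero    n       _       _       = refl
base4F-fuel zero    (suc g) zero    _       _       = refl
base4F-fuel (suc f) zero    zero    _       _       = refl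
base4F-fuel (suc f) (suc g) zero    _       _       = refl
base4F-fuel (suc f) (suc g) (suc m) (s≤s p) (s≤s q) =
  cong (_ ∷_) (base4F-fuel f g (suc m / 4) (≤-trans quarter≤m p) (≤-trans quarter≤m q))
  where quarter≤m = ≤-pred (m/n<m (suc m) 4 (s≤s (s≤s z≤n)))

bits-step : ∀ {m} q r → r < 2 → suc m ≡ r + q * 2 → bits (suc m) ≡ (r ≡ᵇ 1) ∷ bits q
bits-step {m} q r r<2 eq =
  cong₂ (λ a b → (a ≡ᵇ 1) ∷ b) (trans (cong (_% 2) eq) rem)
    (trans (bitsF-fuel m (suc m / 2) (suc m / 2) half≤m ≤-refl) (cong bits (trans (cong (_/ 2) eq) quot)))
  where
  half≤m = ≤-pred (m/n<m (suc m) 2 (s≤s (s≤s z≤n)))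
  rem  = proj₁ (divMod-unique q r 2 r<2)
  quot = proj₂ (divMod-unique q r 2 r<2)

bits-odd : ∀ k → bits (suc (dbl k)) ≡ true ∷ bits k
bits-odd k = bits-step k 1 (s≤s (s≤s z≤n)) (cong suc (dbl≡*2 k))

bits-even : ∀ k → bits (dbl (suc k)) ≡ false ∷ bits (suc k)
bits-even k = bits-step (suc k) 0 (s≤s z≤n) (dbl≡*2 (suc k))

-- Base-4 digits, least significant first, with no digits for 0.
digits4 : ℕ → List ℕ
digits4 n = base4F n n

base4-step : ∀ {m} q r → r < 4 → suc m ≡ r + q * 4 → base4 (suc m) ≡ r ∷ digits4 q
base4-step {m} q r r<4 eq =
  cong₂ _∷_ (trans (cong (_% 4) eq) rem)
    (trans (base4F-fuel m (suc m / 4) (suc m / 4) quarter≤m ≤-refl) (cong digits4 (trans (cong (_/ 4) eq) quot)))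
  where
  quarter≤m = ≤-pred (m/n<m (suc m) 4 (s≤s (s≤s z≤n)))
  rem  = proj₁ (divMod-unique q r 4 r<4)
  quot = proj₂ (divMod-unique q r 4 r<4)

-- The Baum–Sweet series and its functional equation B⁴ = B·(1 + D).

B : PowerSeries
B = baumSweet

-- A trailing 1 does not change the zero runs; two trailing zeros change no parity;
-- a single trailing zero preceded by a 1 is an odd run.
B-odd : ∀ k → B (suc (dbl k)) ≡ B k
B-odd zero    = refl
B-odd (suc k) = cong (λ l → not (oddZeroRun false l)) (bits-odd (suc k))

B-4q+4 : ∀ k → B (dbl (dbl (suc k))) ≡ B (suc k)
B-4q+4 k = cong (λ l → not (oddZeroRun false l))
  (trans (bits-even (suc (dbl k))) (cong (false ∷_) (bits-even k)))

B-4q+2 : ∀ k → B (dbl (suc (dbl k))) ≡ false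
B-4q+2 k = cong (λ l → not (oddZeroRun false l))
  (trans (bits-even (dbl k)) (cong (false ∷_) (bits-odd k)))

D≈XB : D ≈ Xₛ *ₛ B
D≈XB zero    = refl
D≈XB (suc n) = sym (X*-suc B n)

baumSweet-recurrence : fourth B ≈ B +ₛ Xₛ *ₛ sq B
baumSweet-recurrence n with residue4 n
... | 4q+0 zero    = refl
... | 4q+0 (suc q) = trans (fourth-0 B (suc q)) (sym (trans
        (cong₂ _xor_ (B-4q+4 q) (trans (X*-suc (sq B) (suc (suc (suc (dbl (dbl q)))))) (sq-odd B (suc (dbl q))))) (xor-identityʳ _)))
... | 4q+1 q = trans (fourth-1 B q) (sym (trans
        (cong₂ _xor_ (B-odd (dbl q)) (trans (X*-suc (sq B) (dbl (dbl q))) (sq-even B (dbl q)))) (xor-same (B (dbl q)))))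
... | 4q+2 q = trans (fourth-2 B q) (sym
        (cong₂ _xor_ (B-4q+2 q) (trans (X*-suc (sq B) (suc (dbl (dbl q)))) (sq-odd B (dbl q)))))
... | 4q+3 q = trans (fourth-3 B q) (sym (trans
        (cong₂ _xor_ (B-odd (suc (dbl q))) (trans (X*-suc (sq B) (suc (suc (dbl (dbl q))))) (sq-even B (suc (dbl q))))) (xor-same (B (suc (dbl q))))))

baumSweet-equation : fourth B ≈ B *ₛ (oneₛ +ₛ D)
baumSweet-equation = begin
    fourth B                 ≈⟨ baumSweet-recurrence ⟩
    B +ₛ Xₛ *ₛ (B *ₛ B)      ≈⟨ +-cong (≈-sym (*-identityʳ B)) (≈-sym (*-assoc Xₛ B B)) ⟩
    B *ₛ oneₛ +ₛ (Xₛ *ₛ B) *ₛ B ≈⟨ +-cong (≈-refl {B *ₛ oneₛ}) (≈-trans (*-cong (≈-sym D≈XB) (≈-refl {B})) (*-comm D B)) ⟩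
    B *ₛ oneₛ +ₛ B *ₛ D      ≈⟨ ≈-sym (*-distribˡ-+ B oneₛ D) ⟩
    B *ₛ (oneₛ +ₛ D)         ∎
  where open ≈-Reasoning

-- The digit series H (all base-4 digits in {0,1}) and H = (1 + X)·H⁴.

H : PowerSeries
H n = allBinary (digits4 n)

G : PowerSeries
G n = goodDigits (base4 n)

H-4q+0 : ∀ q → H (dbl (dbl q)) ≡ H q
H-4q+0 zero    = refl
H-4q+0 (suc q) = cong allBinary (base4-step (suc q) 0 (s≤s z≤n) (dbl-dbl≡*4 (suc q)))

H-4q+1 : ∀ q → H (suc (dbl (dbl q))) ≡ H q
H-4q+1 q = cong allBinary (base4-step q 1 (s≤s (s≤s z≤n)) (cong suc (dbl-dbl≡*4 q)))

H-4q+2 : ∀ q → H (suc (suc (dbl (dbl q)))) ≡ false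
H-4q+2 q = cong allBinary (base4-step q 2 (s≤s (s≤s (s≤s z≤n))) (cong (λ z → suc (suc z)) (dbl-dbl≡*4 q)))

H-4q+3 : ∀ q → H (suc (suc (suc (dbl (dbl q))))) ≡ false
H-4q+3 q = cong allBinary (base4-step q 3 (s≤s (s≤s (s≤s (s≤s z≤n)))) (cong (λ z → suc (suc (suc z))) (dbl-dbl≡*4 q)))

-- n + 1 has last digit 1 or 2 and binary higher digits exactly when n has
-- last digit 0 or 1 and binary higher digits; that is, G = X·H.
G-suc : ∀ m → G (suc m) ≡ H m
G-suc m with residue4 m
... | 4q+0 q = trans (cong goodDigits (base4-step q 1 (s≤s (s≤s z≤n)) (cong suc (dbl-dbl≡*4 q)))) (sym (H-4q+0 q))
... | 4q+1 q = trans (cong goodDigits (base4-step q 2 (s≤s (s≤s (s≤s z≤n))) (cong (λ z → suc (suc z)) (dbl-dbl≡*4 q)))) (sym (H-4q+1 q))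
... | 4q+2 q = trans (cong goodDigits (base4-step q 3 (s≤s (s≤s (s≤s (s≤s z≤n)))) (cong (λ z → suc (suc (suc z))) (dbl-dbl≡*4 q)))) (sym (H-4q+2 q))
... | 4q+3 q = trans (cong goodDigits (base4-step (suc q) 0 (s≤s z≤n) (dbl-dbl≡*4 (suc q)))) (sym (H-4q+3 q))

G≈XH : G ≈ Xₛ *ₛ H
G≈XH zero    = refl
G≈XH (suc m) = trans (G-suc m) (sym (X*-suc H m))

X*fourth-4q : ∀ f q → (Xₛ *ₛ fourth f) (dbl (dbl q)) ≡ false
X*fourth-4q f zero    = refl
X*fourth-4q f (suc q) = trans (X*-suc (fourth f) (suc (suc (suc (dbl (dbl q)))))) (fourth-3 f q)

digit-recurrence : H ≈ fourth H +ₛ Xₛ *ₛ fourth H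
digit-recurrence n with residue4 n
... | 4q+0 q = trans (H-4q+0 q) (sym (trans (cong₂ _xor_ (fourth-0 H q) (X*fourth-4q H q)) (xor-identityʳ _)))
... | 4q+1 q = trans (H-4q+1 q) (sym (cong₂ _xor_ (fourth-1 H q) (trans (X*-suc (fourth H) (dbl (dbl q))) (fourth-0 H q))))
... | 4q+2 q = trans (H-4q+2 q) (sym (cong₂ _xor_ (fourth-2 H q) (trans (X*-suc (fourth H) (suc (dbl (dbl q)))) (fourth-1 H q))))
... | 4q+3 q = trans (H-4q+3 q) (sym (cong₂ _xor_ (fourth-3 H q) (trans (X*-suc (fourth H) (suc (suc (dbl (dbl q))))) (fourth-2 H q))))

digit-equation : H ≈ (oneₛ +ₛ Xₛ) *ₛ fourth H
digit-equation = ≈-trans digit-recurrence (≈-sym (≈-trans (*-distribʳ-+ (fourth H) oneₛ Xₛ)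
  (+-cong (*-identityˡ (fourth H)) (≈-refl {Xₛ *ₛ fourth H}))))

fourth-* : ∀ f g → fourth (f *ₛ g) ≈ fourth f *ₛ fourth g
fourth-* f g = ≈-trans (sq-cong (sq-* f g)) (sq-* (sq f) (sq g))

fourth-∘ : ∀ U W → W 0 ≡ false → (fourth U ∘ₛ W) ≈ fourth (U ∘ₛ W)
fourth-∘ U W W0 = ≈-trans (∘-* (sq U) (sq U) W W0) (sq-cong (∘-* U U W W0))

K : PowerSeries
K = H ∘ₛ D

K-equation : K ≈ (oneₛ +ₛ D) *ₛ fourth K
K-equation = begin
    H ∘ₛ D                                       ≈⟨ ∘-congˡ D digit-equation ⟩
    ((oneₛ +ₛ Xₛ) *ₛ fourth H) ∘ₛ D              ≈⟨ ∘-* (oneₛ +ₛ Xₛ) (fourth H) D refl ⟩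
    ((oneₛ +ₛ Xₛ) ∘ₛ D) *ₛ (fourth H ∘ₛ D)       ≈⟨ *-cong (∘-+ oneₛ Xₛ D) (fourth-∘ H D refl) ⟩
    ((oneₛ ∘ₛ D) +ₛ (Xₛ ∘ₛ D)) *ₛ fourth K       ≈⟨ *-cong (+-cong (one-∘ D) (X-∘ D refl)) (≈-refl {fourth K}) ⟩
    (oneₛ +ₛ D) *ₛ fourth K                      ∎
  where open ≈-Reasoning

-- B·K is its own fourth power with constant term 1, hence B·K = 1.
BK≈1 : B *ₛ K ≈ oneₛ
BK≈1 = fourth-fixed-point (B *ₛ K) refl (begin
    B *ₛ K                                  ≈⟨ *-cong (≈-refl {B}) K-equation ⟩
    B *ₛ ((oneₛ +ₛ D) *ₛ fourth K)          ≈⟨ ≈-sym (*-assoc B (oneₛ +ₛ D) (fourth K)) ⟩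
    (B *ₛ (oneₛ +ₛ D)) *ₛ fourth K          ≈⟨ *-cong (≈-sym baumSweet-equation) (≈-refl {fourth K}) ⟩
    fourth B *ₛ fourth K                    ≈⟨ ≈-sym (fourth-* B K) ⟩
    fourth (B *ₛ K)                         ∎)
  where open ≈-Reasoning

G∘D≈X : (G ∘ₛ D) ≈ Xₛ
G∘D≈X = begin
    G ∘ₛ D                 ≈⟨ ∘-congˡ D G≈XH ⟩
    (Xₛ *ₛ H) ∘ₛ D         ≈⟨ ∘-* Xₛ H D refl ⟩
    (Xₛ ∘ₛ D) *ₛ K         ≈⟨ *-cong (≈-trans (X-∘ D refl) D≈XB) (≈-refl {K}) ⟩
    (Xₛ *ₛ B) *ₛ K         ≈⟨ *-assoc Xₛ B K ⟩
    Xₛ *ₛ (B *ₛ K)         ≈⟨ *-cong (≈-refl {Xₛ}) BK≈1 ⟩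
    Xₛ *ₛ oneₛ             ≈⟨ *-identityʳ Xₛ ⟩
    Xₛ                     ∎
  where open ≈-Reasoning

-- Since Q(D) = X = G(D) and D = X + O(X²), Q = G coefficientwise.
mainTheorem7 : (Q : PowerSeries) → Q 0 ≡ false →
    (∀ n → (D ∘ₛ Q) n ≡ Xₛ n) → (∀ n → (Q ∘ₛ D) n ≡ Xₛ n) →
    ∀ (n : ℕ) → (Q n ≡ true) ⇔ (goodDigits (base4 n) ≡ true)
mainTheorem7 Q _ _ Q∘D≈X n = mk⇔ (trans (sym (Q≈G n))) (trans (Q≈G n))
  where
  Q≈G : Q ≈ G
  Q≈G = ∘-injective Q G D refl refl (≈-trans Q∘D≈X (≈-sym G∘D≈X))
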